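{- Let $S,T$ be nonempty subsets of $[n-1]$ such that $A=T_n\langle S;T\rangle$ is a walk-ensured Toeplitz matrix. Let $S^\ast,T^\ast$ be subsets of $[n-1]$ with $S\subseteq S^\ast$ and $T\subseteq T^\ast$. If $\gcd(S+T)=\gcd(S^\ast+T^\ast)$, then $T_n\langle S^\ast;T^\ast\rangle$ has matrix period $\gcd(S+T)/\gcd(S\cup T)$.
   Context: Matrices are Boolean ($0,1$ entries with $1+1=1$), and powers are Boolean matrix powers. For nonempty $S,T\subseteq[n-1]$, $T_n\langle S;T\rangle$ denotes the $n\times n$ $(0,1)$-matrix whose $(i,j)$-entry is $1$ if and only if $j-i\in S$ or $i-j\in T$. Its digraph $D(A)$ has vertex set $[n]$ and an arc $(i,j)$ exactly when the $(i,j)$-entry is $1$. $\gcd(S\cup T)$ is the gcd of all elements of $S\cup T$; $\gcd(S+T)=\gcd\{s+t: s\in S,t\in T\}$; $s_1=\min S$. The matrix $A$ is called walk-ensured if there is a positive integer $M$ such that for all vertices $u,v\in[n]$ and every integer $\ell\ge M$ with $v-u\equiv \ell s_1 \pmod{\gcd(S+T)}$, there is a directed walk from $u$ to $v$ of length $\ell$ in $D(A)$. The matrix period of a Boolean square matrix $A$ is the smallest positive integer $p$ for which there is $M$ with $A^m=A^{m+p}$ for all $m\ge M$. -}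

module Defs where

open import Data.Nat using (ℕ; zero; suc; _+_; _*_; _∸_; _≤_; _<_; _⊓_; _≡ᵇ_)
open import Data.Nat.GCD using (gcd)
open import Data.Bool using (Bool; true; false; _∨_)
open import Data.Fin using (Fin; toℕ)
open import Data.List using (List; []; _∷_; foldr; map; concatMap)
open import Data.Bool.ListAction using (any)
open import Data.List.Relation.Unary.All using (All)
open import Data.Integer as ℤ using (ℤ; +_)
import Data.Integer.Divisibility as ℤD
open import Data.Product using (Σ; ∃; _×_)
open import Relation.Binary.PropositionalEquality using (_≡_)

-- Finite subsets of ℕ are represented by lists (duplicates/order irrelevant).
-- A subset of [n-1] = {1,…,n-1}:
SubsetOf : ℕ → List ℕ → Set
SubsetOf n S = All (λ s → 1 ≤ s × s < n) S

_∈ᵇ_ : ℕ → List ℕ → Bool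
k ∈ᵇ S = any (λ s → s ≡ᵇ k) S

-- gcd of all elements of a finite set (gcd of ∅ = 0)
gcdList : List ℕ → ℕ
gcdList = foldr gcd 0

gcdUnion : List ℕ → List ℕ → ℕ
gcdUnion S T = gcd (gcdList S) (gcdList T)

sumset : List ℕ → List ℕ → List ℕ
sumset S T = concatMap (λ s → map (λ t → s + t) T) S

gcdSum : List ℕ → List ℕ → ℕ
gcdSum S T = gcdList (sumset S T)

-- minimum of a nonempty list (value on [] is irrelevant)
minList : List ℕ → ℕ
minList [] = 0
minList (x ∷ xs) = foldr _⊓_ x xs

BMat : ℕ → Set
BMat n = Fin n → Fin n → Bool

-- Toeplitz matrix T_n⟨S;T⟩ : entry (i,j) is 1 iff j - i ∈ S or i - j ∈ T.
-- (Vertices 1..n are represented by Fin n, i.e. 0..n-1; only differences matter.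
--  Truncated subtraction is harmless since 0 ∉ S, T.)
toeplitz : (n : ℕ) → List ℕ → List ℕ → BMat n
toeplitz n S T i j = ((toℕ j ∸ toℕ i) ∈ᵇ S) ∨ ((toℕ i ∸ toℕ j) ∈ᵇ T)

anyFin : (n : ℕ) → (Fin n → Bool) → Bool
anyFin zero f = false
anyFin (suc n) f = f Fin.zero ∨ anyFin n (λ k → f (Fin.suc k))
  where import Data.Fin as Fin

_∧_ : Bool → Bool → Bool
true ∧ b = b
false ∧ b = false

_⊗_ : {n : ℕ} → BMat n → BMat n → BMat n
_⊗_ {n} A B i j = anyFin n (λ k → A i k ∧ B k j)

identity : (n : ℕ) → BMat n
identity n i j = toℕ i ≡ᵇ toℕ j

_^_ : {n : ℕ} → BMat n → ℕ → BMat n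
_^_ {n} A zero = identity n
_^_ {n} A (suc m) = A ⊗ (A ^ m)

data Walk {n : ℕ} (A : BMat n) : Fin n → Fin n → ℕ → Set where
  here : ∀ {u} → Walk A u u 0
  step : ∀ {u w v ℓ} → A u w ≡ true → Walk A w v ℓ → Walk A u v (suc ℓ)

WalkEnsured : (n : ℕ) → List ℕ → List ℕ → Set
WalkEnsured n S T =
  Σ ℕ λ M → 1 ≤ M ×
    (∀ (u v : Fin n) (ℓ : ℕ) → M ≤ ℓ →
      (+ gcdSum S T) ℤD.∣ ((+ toℕ v ℤ.- + toℕ u) ℤ.- + (ℓ * minList S)) →
      Walk (toeplitz n S T) u v ℓ)

EventuallyPeriodic : {n : ℕ} → BMat n → ℕ → Set
EventuallyPeriodic A p =
  ∃ λ M → ∀ m → M ≤ m → ∀ i j → (A ^ m) i j ≡ (A ^ (m + p)) i j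

HasMatrixPeriod : {n : ℕ} → BMat n → ℕ → Set
HasMatrixPeriod A p =
  1 ≤ p × EventuallyPeriodic A p ×
  (∀ q → 1 ≤ q → EventuallyPeriodic A q → p ≤ q)

_⊆_ : List ℕ → List ℕ → Set
S ⊆ S' = ∀ {x} → x ∈ S → x ∈ S'
  where open import Data.List.Membership.Propositional using (_∈_)

{-# OPTIONS --safe #-}
-- Every arc of D(T_n⟨S*;T*⟩) moves a vertex by some s ∈ S* or by −t with t ∈ T*.
-- As g = gcd(S*+T*) divides every s + t, all these moves are ≡ s₁ (mod g), so a
-- walk of length ℓ from u to v forces v − u ≡ ℓ s₁ (mod g); walk-ensuredness of the
-- smaller matrix T_n⟨S;T⟩ supplies the converse for all large ℓ. Hence A^m is, for
-- large m, a function of m s₁ mod g, and A^m = A^{m+p} eventually iff g ∣ p s₁.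
-- Since s ≡ s₁ and −t ≡ s₁ (mod g) for s ∈ S, t ∈ T, this happens iff
-- g ∣ p·gcd(S∪T), i.e. iff g / gcd(S∪T) divides p.
module Submission where

open import Defs
open import Data.Nat using (ℕ; _*_)
open import Data.List using (List; [])
open import Relation.Binary.PropositionalEquality using (_≡_; _≢_)

open import Data.Bool using (Bool; true; false; _∨_)
open import Data.Bool.Properties using (T-≡; ∨-zeroʳ)
open import Data.Empty using (⊥-elim)
open import Data.Fin using (Fin; toℕ; fromℕ<)
import Data.Fin as Fin
open import Data.Fin.Properties using (toℕ-injective)
open import Data.Integer as ℤ using (ℤ; +_; -_; 0ℤ)
import Data.Integer.Properties as ℤ
open import Data.Integer.Divisibility.Signed using (∣ᵤ⇒∣; ∣⇒∣ᵤ; ∣m⇒∣-m; ∣m∣n⇒∣m+n; ∣n⇒∣m*n)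
  renaming (_∣_ to _∣ℤ_)
open import Data.Integer.Tactic.RingSolver using (solve-∀)
open import Data.List using (_∷_; map)
open import Data.List.Membership.Propositional using (_∈_)
open import Data.List.Membership.Propositional.Properties using (∈-map⁺; ∈-concatMap⁺; foldr-selective)
open import Data.List.Relation.Unary.Any as Any using (here; there)
open import Data.List.Relation.Unary.Any.Properties using (any⁺; any⁻)
import Data.List.Relation.Unary.All as All
open import Data.Nat using (suc; zero; s≤s; z≤n; _+_; _∸_; _≤_; NonZero; >-nonZero; ≢-nonZero⁻¹)
import Data.Nat.Properties as ℕ
open import Data.Nat.Divisibility using (_∣_; _∣0; ∣-trans; n∣m*n; m∣m*n; ∣⇒≤; 0∣⇒≡0; *-monoʳ-∣; *-cancelʳ-∣)
open import Data.Nat.GCD using (gcd; gcd[m,n]∣m; gcd[m,n]∣n; gcd-greatest; c*gcd[m,n]≡gcd[cm,cn])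
open import Data.Product using (∃; _×_; _,_; proj₁; proj₂)
open import Data.Sum using (_⊎_; inj₁; inj₂; [_,_]′)
open import Function.Bundles using (Equivalence)
open import Level using (0ℓ)
open import Relation.Binary.Bundles using (Setoid)
open import Relation.Binary.PropositionalEquality using (refl; sym; trans; cong; subst)

true-ext : ∀ {a b : Bool} → (a ≡ true → b ≡ true) → (b ≡ true → a ≡ true) → a ≡ b
true-ext {true}          a⇒b _   = sym (a⇒b refl)
true-ext {false} {true}  _ b⇒a = b⇒a refl
true-ext {false} {false} _ _   = refl

∨-true⁻ : ∀ a {b} → a ∨ b ≡ true → a ≡ true ⊎ b ≡ true
∨-true⁻ true  _ = inj₁ refl
∨-true⁻ false b = inj₂ b

∨-true⁺ : ∀ {a b} → a ≡ true ⊎ b ≡ true → a ∨ b ≡ true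
∨-true⁺         (inj₁ refl) = refl
∨-true⁺ {a = a} (inj₂ refl) = ∨-zeroʳ a

∧-true⁻ : ∀ a {b} → a ∧ b ≡ true → a ≡ true × b ≡ true
∧-true⁻ true b = refl , b

∧-true⁺ : ∀ {a b} → a ≡ true → b ≡ true → a ∧ b ≡ true
∧-true⁺ refl b = b

anyFin⁻ : ∀ n (f : Fin n → Bool) → anyFin n f ≡ true → ∃ λ k → f k ≡ true
anyFin⁻ (suc n) f any-f with f Fin.zero in f0
... | true  = Fin.zero , f0
... | false with anyFin⁻ n (λ k → f (Fin.suc k)) any-f
...   | k , fk = Fin.suc k , fk

anyFin⁺ : ∀ n (f : Fin n → Bool) k → f k ≡ true → anyFin n f ≡ true
anyFin⁺ (suc n) f Fin.zero    fk = ∨-true⁺ (inj₁ fk)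
anyFin⁺ (suc n) f (Fin.suc k) fk = ∨-true⁺ (inj₂ (anyFin⁺ n (λ k → f (Fin.suc k)) k fk))

^⇒Walk : ∀ {n} (A : BMat n) m {u v} → (A ^ m) u v ≡ true → Walk A u v m
^⇒Walk A zero {u} {v} Iuv =
  subst (λ v → Walk A u v 0) (toℕ-injective (ℕ.≡ᵇ⇒≡ (toℕ u) (toℕ v) (Equivalence.from T-≡ Iuv))) here
^⇒Walk {n} A (suc m) {u} {v} Amuv with anyFin⁻ n _ Amuv
... | w , Auw∧Amwv with ∧-true⁻ (A u w) Auw∧Amwv
...   | Auw , Amwv = step Auw (^⇒Walk A m Amwv)

Walk⇒^ : ∀ {n} {A : BMat n} {u v m} → Walk A u v m → (A ^ m) u v ≡ true
Walk⇒^ {u = u} here = Equivalence.to T-≡ (ℕ.≡⇒≡ᵇ (toℕ u) (toℕ u) refl)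
Walk⇒^ {n} (step {w = w} Auw walk) = anyFin⁺ n _ w (∧-true⁺ Auw (Walk⇒^ walk))

_≤ᴮ_ : ∀ {n} → BMat n → BMat n → Set
A ≤ᴮ B = ∀ u w → A u w ≡ true → B u w ≡ true

Walk-mono : ∀ {n} {A B : BMat n} → A ≤ᴮ B → ∀ {u v ℓ} → Walk A u v ℓ → Walk B u v ℓ
Walk-mono A≤B here                  = here
Walk-mono A≤B (step {u} {w} a walk) = step (A≤B u w a) (Walk-mono A≤B walk)

displacement : ∀ {n} → Fin n → Fin n → ℤ
displacement u v = + toℕ v ℤ.- + toℕ u

displacement-refl : ∀ {n} (u : Fin n) → displacement u u ≡ 0ℤ
displacement-refl u = ℤ.+-inverseʳ (+ toℕ u)

displacement-trans : ∀ {n} (u w v : Fin n) →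
  displacement u v ≡ displacement u w ℤ.+ displacement w v
displacement-trans u w v = telescope (+ toℕ u) (+ toℕ w) (+ toℕ v)
  where
  telescope : ∀ x y z → z ℤ.- x ≡ (y ℤ.- x) ℤ.+ (z ℤ.- y)
  telescope = solve-∀

∈ᵇ⇒∈ : ∀ {k} S → k ∈ᵇ S ≡ true → k ∈ S
∈ᵇ⇒∈ S k∈ᵇS = Any.map (λ s≡ᵇk → sym (ℕ.≡ᵇ⇒≡ _ _ s≡ᵇk)) (any⁻ _ S (Equivalence.from T-≡ k∈ᵇS))

∈⇒∈ᵇ : ∀ {k S} → k ∈ S → k ∈ᵇ S ≡ true
∈⇒∈ᵇ k∈S = Equivalence.to T-≡ (any⁺ _ (Any.map (λ k≡s → ℕ.≡⇒≡ᵇ _ _ (sym k≡s)) k∈S))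

toeplitz-mono : ∀ {n S T S* T*} → S ⊆ S* → T ⊆ T* → toeplitz n S T ≤ᴮ toeplitz n S* T*
toeplitz-mono {S = S} {T} S⊆S* T⊆T* u w arc with ∨-true⁻ _ arc
... | inj₁ s = ∨-true⁺ (inj₁ (∈⇒∈ᵇ (S⊆S* (∈ᵇ⇒∈ S s))))
... | inj₂ t = ∨-true⁺ (inj₂ (∈⇒∈ᵇ (T⊆T* (∈ᵇ⇒∈ T t))))

toeplitz-arc : ∀ {n S T} → SubsetOf n S → SubsetOf n T → ∀ u w → toeplitz n S T u w ≡ true →
  (∃ λ s → s ∈ S × displacement u w ≡ + s) ⊎ (∃ λ t → t ∈ T × displacement u w ≡ - + t)
toeplitz-arc {S = S} {T} S⊂[n] T⊂[n] u w arc with ∨-true⁻ _ arc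
... | inj₁ s = inj₁ (_ , s∈S , trans (ℤ.m-n≡m⊖n (toℕ w) (toℕ u)) (ℤ.⊖-≥ u≤w))
  where
  s∈S : toℕ w ∸ toℕ u ∈ S
  s∈S = ∈ᵇ⇒∈ S s
  u≤w : toℕ u ≤ toℕ w
  u≤w = ℕ.<⇒≤ (ℕ.m∸n≢0⇒n<m (ℕ.m<n⇒n≢0 (proj₁ (All.lookup S⊂[n] s∈S))))
... | inj₂ t = inj₂ (_ , t∈T , trans (ℤ.m-n≡m⊖n (toℕ w) (toℕ u)) (ℤ.⊖-≤ w≤u))
  where
  t∈T : toℕ u ∸ toℕ w ∈ T
  t∈T = ∈ᵇ⇒∈ T t
  w≤u : toℕ w ≤ toℕ u
  w≤u = ℕ.<⇒≤ (ℕ.m∸n≢0⇒n<m (ℕ.m<n⇒n≢0 (proj₁ (All.lookup T⊂[n] t∈T))))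

minList-∈ : ∀ {S} → S ≢ [] → minList S ∈ S
minList-∈ {[]}     S≢[] = ⊥-elim (S≢[] refl)
minList-∈ {x ∷ xs} _    = [ here , there ]′ (foldr-selective ℕ.⊓-sel x xs)

nonEmpty-∈ : ∀ {S : List ℕ} → S ≢ [] → ∃ λ x → x ∈ S
nonEmpty-∈ {[]}    S≢[] = ⊥-elim (S≢[] refl)
nonEmpty-∈ {x ∷ _} _    = x , here refl

∈-sumset : ∀ {s t S T} → s ∈ S → t ∈ T → s + t ∈ sumset S T
∈-sumset {s} {t} {T = T} s∈S t∈T =
  ∈-concatMap⁺ _ (Any.map (λ s≡x → subst (λ x → s + t ∈ map (_+_ x) T) s≡x (∈-map⁺ (_+_ s) t∈T))
                          s∈S)

gcdList-∣ : ∀ {x L} → x ∈ L → gcdList L ∣ x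
gcdList-∣ {L = x ∷ xs} (here refl) = gcd[m,n]∣m x (gcdList xs)
gcdList-∣ {L = y ∷ ys} (there x∈ys) = ∣-trans (gcd[m,n]∣n y (gcdList ys)) (gcdList-∣ x∈ys)

∣*gcdList : ∀ {k p} L → (∀ {x} → x ∈ L → k ∣ p * x) → k ∣ p * gcdList L
∣*gcdList {k} {p} []       _      = subst (k ∣_) (sym (ℕ.*-zeroʳ p)) (k ∣0)
∣*gcdList {k} {p} (x ∷ xs) k∣p*xs = subst (k ∣_) (sym (c*gcd[m,n]≡gcd[cm,cn] p x (gcdList xs)))
  (gcd-greatest (k∣p*xs (here refl)) (∣*gcdList {p = p} xs (λ x∈xs → k∣p*xs (there x∈xs))))

gcdSum-∣ : ∀ {s t S T} → s ∈ S → t ∈ T → gcdSum S T ∣ s + t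
gcdSum-∣ s∈S t∈T = gcdList-∣ (∈-sumset s∈S t∈T)

gcdSum-nonZero : ∀ {s t S T} → 1 ≤ s → s ∈ S → t ∈ T → NonZero (gcdSum S T)
gcdSum-nonZero {s} {t} {S} {T} 1≤s s∈S t∈T with gcdSum S T | gcdSum-∣ s∈S t∈T
... | zero  | 0∣s+t = ⊥-elim (ℕ.m<n⇒n≢0 (ℕ.≤-trans 1≤s (ℕ.m≤m+n s t)) (0∣⇒≡0 0∣s+t))
... | suc _ | _     = _

gcdUnion-∣ˡ : ∀ {x S} T → x ∈ S → gcdUnion S T ∣ x
gcdUnion-∣ˡ {S = S} T x∈S = ∣-trans (gcd[m,n]∣m (gcdList S) (gcdList T)) (gcdList-∣ x∈S)

∣*gcdUnion : ∀ {k p} S T → (∀ {x} → x ∈ S → k ∣ p * x) → (∀ {x} → x ∈ T → k ∣ p * x) →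
  k ∣ p * gcdUnion S T
∣*gcdUnion {k} {p} S T k∣p*S k∣p*T =
  subst (k ∣_) (sym (c*gcd[m,n]≡gcd[cm,cn] p (gcdList S) (gcdList T)))
  (gcd-greatest (∣*gcdList {p = p} S k∣p*S) (∣*gcdList {p = p} T k∣p*T))

quotient-pos : ∀ {q d g} .{{_ : NonZero g}} → q * d ≡ g → 1 ≤ q
quotient-pos {zero}  {g = g} 0≡g = ⊥-elim (≢-nonZero⁻¹ g (sym 0≡g))
quotient-pos {suc _} _           = s≤s z≤n

quotient-∣ : ∀ {q d g p} .{{g≢0 : NonZero g}} → q * d ≡ g → g ∣ p * d → q ∣ p
quotient-∣ {q} {d} {{g≢0}} q*d≡g g∣p*d =
  *-cancelʳ-∣ d {{ℕ.m*n≢0⇒n≢0 q {{subst NonZero (sym q*d≡g) g≢0}}}} (subst (_∣ _) (sym q*d≡g) g∣p*d)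

module Modulo (g : ℕ) where

  infix 4 _≈_
  record _≈_ (x y : ℤ) : Set where
    constructor ∣⇒≈
    field ≈⇒∣ : + g ∣ℤ x ℤ.- y
  open _≈_ public

  private
    sym-lemma : ∀ x y → - (x ℤ.- y) ≡ y ℤ.- x
    sym-lemma = solve-∀

    trans-lemma : ∀ x y z → (x ℤ.- y) ℤ.+ (y ℤ.- z) ≡ x ℤ.- z
    trans-lemma = solve-∀

    +-lemma : ∀ x y u v → (x ℤ.- y) ℤ.+ (u ℤ.- v) ≡ (x ℤ.+ u) ℤ.- (y ℤ.+ v)
    +-lemma = solve-∀

    *-lemma : ∀ p x y → p ℤ.* (x ℤ.- y) ≡ p ℤ.* x ℤ.- p ℤ.* y
    *-lemma = solve-∀

  ≈-refl : ∀ {x} → x ≈ x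
  ≈-refl {x} = ∣⇒≈ (subst (+ g ∣ℤ_) (sym (ℤ.+-inverseʳ x)) (∣ᵤ⇒∣ (g ∣0)))

  ≈-sym : ∀ {x y} → x ≈ y → y ≈ x
  ≈-sym {x} {y} (∣⇒≈ x-y) = ∣⇒≈ (subst (+ g ∣ℤ_) (sym-lemma x y) (∣m⇒∣-m x-y))

  ≈-trans : ∀ {x y z} → x ≈ y → y ≈ z → x ≈ z
  ≈-trans {x} {y} {z} (∣⇒≈ x-y) (∣⇒≈ y-z) =
    ∣⇒≈ (subst (+ g ∣ℤ_) (trans-lemma x y z) (∣m∣n⇒∣m+n x-y y-z))

  ≈-setoid : Setoid 0ℓ 0ℓ
  ≈-setoid = record
    { _≈_ = _≈_
    ; isEquivalence = record { refl = ≈-refl ; sym = ≈-sym ; trans = ≈-trans }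
    }

  open import Relation.Binary.Reasoning.Setoid ≈-setoid

  +-cong : ∀ {x y u v} → x ≈ y → u ≈ v → x ℤ.+ u ≈ y ℤ.+ v
  +-cong {x} {y} {u} {v} (∣⇒≈ x-y) (∣⇒≈ u-v) =
    ∣⇒≈ (subst (+ g ∣ℤ_) (+-lemma x y u v) (∣m∣n⇒∣m+n x-y u-v))

  *-congˡ : ∀ p {x y} → x ≈ y → p ℤ.* x ≈ p ℤ.* y
  *-congˡ p {x} {y} (∣⇒≈ x-y) = ∣⇒≈ (subst (+ g ∣ℤ_) (*-lemma p x y) (∣n⇒∣m*n p x-y))

  ∣⇒≈0 : ∀ {k} → g ∣ k → + k ≈ 0ℤ
  ∣⇒≈0 {k} g∣k = ∣⇒≈ (subst (+ g ∣ℤ_) (sym (ℤ.+-identityʳ (+ k))) (∣ᵤ⇒∣ g∣k))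

  ≈0⇒∣ : ∀ {x} → x ≈ 0ℤ → g ∣ ℤ.∣ x ∣
  ≈0⇒∣ {x} (∣⇒≈ x-0) = ∣⇒∣ᵤ (subst (+ g ∣ℤ_) (ℤ.+-identityʳ x) x-0)

  ≈+-multiple : ∀ {k} → g ∣ k → ∀ m → + m ≈ + (m + k)
  ≈+-multiple {k} g∣k m = begin
    + m           ≡⟨ ℤ.+-identityʳ (+ m) ⟨
    + m ℤ.+ 0ℤ    ≈⟨ +-cong (≈-refl {+ m}) (≈-sym (∣⇒≈0 g∣k)) ⟩
    + (m + k)     ∎

  ∣+⇒≈- : ∀ {s t} → g ∣ s + t → + s ≈ - + t
  ∣+⇒≈- {s} {t} g∣s+t =
    ∣⇒≈ (subst (+ g ∣ℤ_) (cong (ℤ._+_ (+ s)) (sym (ℤ.neg-involutive (+ t)))) (∣ᵤ⇒∣ g∣s+t))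

  StepsCongruent : List ℕ → List ℕ → ℕ → Set
  StepsCongruent S T c = (∀ {s} → s ∈ S → + s ≈ + c) × (∀ {t} → t ∈ T → - + t ≈ + c)

  ∣sums⇒StepsCongruent : ∀ {S T c t₀} → (∀ {s t} → s ∈ S → t ∈ T → g ∣ s + t) →
    c ∈ S → t₀ ∈ T → StepsCongruent S T c
  ∣sums⇒StepsCongruent g∣S+T c∈S t₀∈T =
    (λ s∈S → ≈-trans (∣+⇒≈- (g∣S+T s∈S t₀∈T)) (≈-sym (∣+⇒≈- (g∣S+T c∈S t₀∈T)))) ,
    (λ t∈T → ≈-sym (∣+⇒≈- (g∣S+T c∈S t∈T)))

  StepsCongruent-⊆ : ∀ {S T S* T* c} → S ⊆ S* → T ⊆ T* →
    StepsCongruent S* T* c → StepsCongruent S T c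
  StepsCongruent-⊆ S⊆S* T⊆T* (S*≈ , T*≈) = (λ s∈S → S*≈ (S⊆S* s∈S)) , (λ t∈T → T*≈ (T⊆T* t∈T))

  toeplitz-arc-≈ : ∀ {n S T c} → SubsetOf n S → SubsetOf n T → StepsCongruent S T c →
    ∀ u w → toeplitz n S T u w ≡ true → displacement u w ≈ + c
  toeplitz-arc-≈ {c = c} S⊂[n] T⊂[n] (S≈ , T≈) u w arc with toeplitz-arc S⊂[n] T⊂[n] u w arc
  ... | inj₁ (_ , s∈S , u→w≡s)  = subst (_≈ + c) (sym u→w≡s) (S≈ s∈S)
  ... | inj₂ (_ , t∈T , u→w≡-t) = subst (_≈ + c) (sym u→w≡-t) (T≈ t∈T)

  walk-displacement : ∀ {n} {A : BMat n} {c} →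
    (∀ u w → A u w ≡ true → displacement u w ≈ + c) →
    ∀ {u v ℓ} → Walk A u v ℓ → displacement u v ≈ + (ℓ * c)
  walk-displacement arc {u} here = subst (_≈ 0ℤ) (sym (displacement-refl u)) ≈-refl
  walk-displacement {c = c} arc (step {u} {w} {v} {ℓ} a walk) = begin
    displacement u v                      ≡⟨ displacement-trans u w v ⟩
    displacement u w ℤ.+ displacement w v ≈⟨ +-cong (arc u w a) (walk-displacement arc walk) ⟩
    + c ℤ.+ + (ℓ * c)                     ∎

  StepsCongruent⇒∣*gcdUnion : ∀ {S T c p} → StepsCongruent S T c →
    g ∣ p * c → g ∣ p * gcdUnion S T
  StepsCongruent⇒∣*gcdUnion {S} {T} {c} {p} (S≈ , T≈) g∣p*c = ∣*gcdUnion {p = p} S T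
    (λ {x} x∈S → ≈0⇒∣ (subst (_≈ 0ℤ) (sym (ℤ.pos-* p x)) (p*≈0 (S≈ x∈S))))
    (λ {x} x∈T → subst (g ∣_) (ℤ.∣-i∣≡∣i∣ (+ (p * x)))
      (≈0⇒∣ (subst (_≈ 0ℤ) (sym (neg-pos-* x)) (p*≈0 (T≈ x∈T)))))
    where
    p*≈0 : ∀ {x} → x ≈ + c → + p ℤ.* x ≈ 0ℤ
    p*≈0 {x} x≈c = begin
      + p ℤ.* x    ≈⟨ *-congˡ (+ p) x≈c ⟩
      + p ℤ.* + c  ≡⟨ ℤ.pos-* p c ⟨
      + (p * c)    ≈⟨ ∣⇒≈0 g∣p*c ⟩
      0ℤ           ∎
    neg-pos-* : ∀ x → - + (p * x) ≡ + p ℤ.* - + x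
    neg-pos-* x = trans (cong -_ (ℤ.pos-* p x)) (ℤ.neg-distribʳ-* (+ p) (+ x))

  module EventualPeriod {n} (A : BMat n) (c M : ℕ)
    (sound : ∀ m u v → (A ^ m) u v ≡ true → displacement u v ≈ + (m * c))
    (complete : ∀ m u v → M ≤ m → displacement u v ≈ + (m * c) → (A ^ m) u v ≡ true)
    where
    ∣⇒periodic : ∀ {p} → g ∣ p * c → EventuallyPeriodic A p
    ∣⇒periodic {p} g∣p*c = M , λ m M≤m u v → true-ext
      (λ Am → complete (m + p) u v (ℕ.≤-trans M≤m (ℕ.m≤m+n m p))
                (≈-trans (sound m u v Am) (shift m)))
      (λ Am+p → complete m u v M≤m (≈-trans (sound (m + p) u v Am+p) (≈-sym (shift m))))
      where
      shift : ∀ m → + (m * c) ≈ + ((m + p) * c)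
      shift m = subst (λ k → + (m * c) ≈ + k) (sym (ℕ.*-distribʳ-+ c m p))
                      (≈+-multiple g∣p*c (m * c))

    -- Every large multiple m of g is the length of a closed walk at u, and a
    -- period p turns it into one of length m + p.
    periodic⇒∣ : .{{_ : NonZero g}} → Fin n → ∀ {p} → EventuallyPeriodic A p → g ∣ p * c
    periodic⇒∣ u {p} (M′ , A^m≡A^m+p) = ≈0⇒∣ (begin
      + (p * c)                ≈⟨ ≈+-multiple g∣m*c (p * c) ⟩
      + (p * c + m * c)        ≡⟨ cong +_ (trans (ℕ.*-distribʳ-+ c m p) (ℕ.+-comm (m * c) (p * c))) ⟨
      + ((m + p) * c)          ≈⟨ sound (m + p) u u closed-m+p ⟨
      displacement u u         ≡⟨ displacement-refl u ⟩
      0ℤ                       ∎)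
      where
      m = (M + M′) * g
      M+M′≤m : M + M′ ≤ m
      M+M′≤m = ℕ.m≤m*n (M + M′) g
      g∣m*c : g ∣ m * c
      g∣m*c = ∣-trans (n∣m*n (M + M′)) (m∣m*n c)
      closed-m : (A ^ m) u u ≡ true
      closed-m = complete m u u (ℕ.≤-trans (ℕ.m≤m+n M M′) M+M′≤m)
        (subst (_≈ + (m * c)) (sym (displacement-refl u)) (≈-sym (∣⇒≈0 g∣m*c)))
      closed-m+p : (A ^ (m + p)) u u ≡ true
      closed-m+p = trans (sym (A^m≡A^m+p m (ℕ.≤-trans (ℕ.m≤n+m M′ M) M+M′≤m) u u)) closed-m

theorem4p2 : (n : ℕ) (S T S* T* : List ℕ) →
    S ≢ [] → T ≢ [] → SubsetOf n S → SubsetOf n T →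
    WalkEnsured n S T →
    SubsetOf n S* → SubsetOf n T* → S ⊆ S* → T ⊆ T* →
    gcdSum S T ≡ gcdSum S* T* →
    (q : ℕ) → q * gcdUnion S T ≡ gcdSum S T →
    HasMatrixPeriod (toeplitz n S* T*) q
theorem4p2 n S T S* T* S≢[] T≢[] S⊂[n] _ (M , _ , walkEnsured) S*⊂[n] T*⊂[n] S⊆S* T⊆T* g≡g* q q*d≡g =
  quotient-pos q*d≡g , ∣⇒periodic g∣q*s₁ , minimal
  where
  open Modulo (gcdSum S T)
  s₁∈S = minList-∈ S≢[]
  t₀∈T = proj₂ (nonEmpty-∈ T≢[])
  instance
    g≢0 : NonZero (gcdSum S T)
    g≢0 = gcdSum-nonZero (proj₁ (All.lookup S⊂[n] s₁∈S)) s₁∈S t₀∈T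
  steps* : StepsCongruent S* T* (minList S)
  steps* = ∣sums⇒StepsCongruent (λ s∈ t∈ → subst (_∣ _) (sym g≡g*) (gcdSum-∣ s∈ t∈))
                                 (S⊆S* s₁∈S) (T⊆T* t₀∈T)
  open EventualPeriod (toeplitz n S* T*) (minList S) M
    (λ m _ _ A*ᵐ →
      walk-displacement (toeplitz-arc-≈ S*⊂[n] T*⊂[n] steps*) (^⇒Walk (toeplitz n S* T*) m A*ᵐ))
    (λ m u v M≤m u→v≈ →
      Walk⇒^ (Walk-mono (toeplitz-mono S⊆S* T⊆T*) (walkEnsured u v m M≤m (∣⇒∣ᵤ (≈⇒∣ u→v≈)))))
  g∣q*s₁ : gcdSum S T ∣ q * minList S
  g∣q*s₁ = subst (_∣ q * minList S) q*d≡g (*-monoʳ-∣ q (gcdUnion-∣ˡ T s₁∈S))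
  minimal : ∀ p → 1 ≤ p → EventuallyPeriodic (toeplitz n S* T*) p → q ≤ p
  minimal p 1≤p periodic = ∣⇒≤ {{>-nonZero 1≤p}} (quotient-∣ {p = p} q*d≡g
    (StepsCongruent⇒∣*gcdUnion {p = p} (StepsCongruent-⊆ S⊆S* T⊆T* steps*)
      (periodic⇒∣ (fromℕ< (proj₂ (All.lookup S⊂[n] s₁∈S))) periodic)))
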